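{- For integers $n\geq j\geq 1$, \[ \sum_{k=j}^{n}\left[ {n+1 \atop k+1}\right]\left\{ {k \atop j}\right\} k=\binom{n+1}{j}\frac{n!}{(j-1)!}\left(H_{n+1}-H_{j}\right). \]
   Context: $\left\{ {n \atop k}\right\}$ denotes the Stirling number of the second kind and $\left[ {n \atop k}\right]$ the unsigned Stirling number of the first kind. $H_k=\sum_{i=1}^k 1/i$ is the $k$-th harmonic number. -}

module Defs where

open import Data.Nat using (ℕ; zero; suc; _+_; _*_; _∸_)
open import Data.Nat.Properties using (_!≢0)
open import Data.Nat.Combinatorics using (_C_)
open import Data.Nat.Base using (_!)
open import Data.Integer using (+_)
open import Data.Rational using (ℚ; _/_; 0ℚ)
import Data.Rational as Q

stirling2 : ℕ → ℕ → ℕ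
stirling2 zero    zero    = 1
stirling2 zero    (suc k) = 0
stirling2 (suc n) zero    = 0
stirling2 (suc n) (suc k) = suc k * stirling2 n (suc k) + stirling2 n k

stirling1 : ℕ → ℕ → ℕ
stirling1 zero    zero    = 1
stirling1 zero    (suc k) = 0
stirling1 (suc n) zero    = 0
stirling1 (suc n) (suc k) = n * stirling1 n (suc k) + stirling1 n k

harmonic : ℕ → ℚ
harmonic zero    = 0ℚ
harmonic (suc k) = harmonic k Q.+ (+ 1 / suc k)

-- Σ_{k=a}^{b} f k  (empty when b < a), over ℕ
sumCount : ℕ → ℕ → (ℕ → ℕ) → ℕ
sumCount a zero    f = 0
sumCount a (suc c) f = f a + sumCount (suc a) c f

sumFromTo : ℕ → ℕ → (ℕ → ℕ) → ℕ
sumFromTo a b f = sumCount a (suc b ∸ a) f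

factQ : ℕ → ℕ → ℚ
factQ n m = (+ (n !) / (m !)) {{m !≢0}}

{-# OPTIONS --safe #-}
module Submission where

open import Defs
open import Data.Nat using (ℕ; suc; _*_; _∸_; _≤_)
open import Data.Nat.Combinatorics using (_C_)
open import Data.Integer using (+_)
open import Data.Rational using (ℚ; _/_)
open import Data.Rational using () renaming (_*_ to _*q_; _-_ to _-q_)
open import Relation.Binary.PropositionalEquality using (_≡_)

open import Data.Nat using (zero; _+_; _<_; _!; z≤n; s≤s; NonZero)
open import Data.Nat.Properties
  using ( _!≢0; +-commutativeSemigroup; *-commutativeSemigroup; +-comm; +-assoc; +-suc; +-identityʳ
        ; *-comm; *-assoc; *-identityˡ; *-identityʳ; *-zeroʳ; *-distribˡ-+
        ; n<1+n; m<n⇒m<1+n; m≤n⇒m≤1+n; m+[n∸m]≡n )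
open import Data.Nat.Combinatorics using (nC1≡n; k>n⇒nCk≡0; nCk+nC[k+1]≡[n+1]C[k+1])
open import Data.Nat.Tactic.RingSolver using (solve-∀)
open import Algebra.Properties.CommutativeSemigroup +-commutativeSemigroup using (interchange)
open import Algebra.Properties.CommutativeSemigroup *-commutativeSemigroup using (x∙yz≈y∙xz)
import Data.Integer as ℤ
import Data.Integer.Properties as ℤ
import Data.Integer.Tactic.RingSolver as ℤ-Solver
open import Data.Rational using (0ℚ; toℚᵘ) renaming (_+_ to _+q_)
import Data.Rational.Properties as ℚ
open import Data.Rational.Unnormalised using (mkℚᵘ)
import Data.Rational.Unnormalised as ℚᵘ
import Data.Rational.Unnormalised.Properties as ℚᵘ
open import Tactic.RingSolver.Core.AlmostCommutativeRing
  using (AlmostCommutativeRing; fromCommutativeRing)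
import Tactic.RingSolver as RingSolver
open import Function using (_∘_)
open import Level using (0ℓ)
open import Relation.Nullary.Decidable using (dec⇒maybe)
open import Relation.Binary.PropositionalEquality
  using (refl; sym; trans; cong; cong₂; module ≡-Reasoning)
open ≡-Reasoning

-- Idea: write  mixed₀ n j = Σ_{k≤n} [n+1, k+1] {k, j}  and  mixed₁ n j = Σ_{k≤n} [n+1, k+1] {k, j} k.
-- Splitting [n+2, k+1] = (n+1) [n+1, k+1] + [n+1, k] and shifting the index in the second
-- part turns {k, j} into {k+1, j+1} = (j+1) {k, j+1} + {k, j}, which gives recurrences for
-- both sums in (n, j).  By induction, mixed₀ n j · j! = C(n, j) n!, and then
-- mixed₁ n j · j! = j C(n+1, j) n! (H_{n+1} − H_j): in the inductive step the harmonic
-- differences of the three indices involved differ by 1/(j+1) and 1/(n+2), and these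
-- cancel against the factors j+1 and n+2 produced by the recurrence and by the absorption
-- identity (n+1) C(n, k) = (k+1) C(n+1, k+1).

sumCount-cong : ∀ a c {f g : ℕ → ℕ} → (∀ k → f k ≡ g k) → sumCount a c f ≡ sumCount a c g
sumCount-cong a zero    f≗g = refl
sumCount-cong a (suc c) f≗g = cong₂ _+_ (f≗g a) (sumCount-cong (suc a) c f≗g)

sumCount-distrib-+ : ∀ a c (f g : ℕ → ℕ) →
  sumCount a c (λ k → f k + g k) ≡ sumCount a c f + sumCount a c g
sumCount-distrib-+ a zero    f g = refl
sumCount-distrib-+ a (suc c) f g =
  trans (cong (λ s → f a + g a + s) (sumCount-distrib-+ (suc a) c f g))
        (interchange (f a) (g a) (sumCount (suc a) c f) (sumCount (suc a) c g))

*-distribˡ-sumCount : ∀ m a c (f : ℕ → ℕ) → sumCount a c (λ k → m * f k) ≡ m * sumCount a c f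
*-distribˡ-sumCount m a zero    f = sym (*-zeroʳ m)
*-distribˡ-sumCount m a (suc c) f =
  trans (cong (λ s → m * f a + s) (*-distribˡ-sumCount m (suc a) c f))
        (sym (*-distribˡ-+ m (f a) (sumCount (suc a) c f)))

sumCount-shift : ∀ a c (f : ℕ → ℕ) → sumCount (suc a) c f ≡ sumCount a c (f ∘ suc)
sumCount-shift a zero    f = refl
sumCount-shift a (suc c) f = cong (λ s → f (suc a) + s) (sumCount-shift (suc a) c f)

sumCount-last : ∀ a c (f : ℕ → ℕ) → sumCount a (suc c) f ≡ sumCount a c f + f (a + c)
sumCount-last a zero    f = trans (+-identityʳ (f a)) (cong f (sym (+-identityʳ a)))
sumCount-last a (suc c) f = begin
  f a + sumCount (suc a) (suc c) f
    ≡⟨ cong (λ s → f a + s) (sumCount-last (suc a) c f) ⟩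
  f a + (sumCount (suc a) c f + f (suc a + c))
    ≡⟨ +-assoc (f a) (sumCount (suc a) c f) (f (suc a + c)) ⟨
  f a + sumCount (suc a) c f + f (suc a + c)
    ≡⟨ cong (λ m → f a + sumCount (suc a) c f + f m) (+-suc a c) ⟨
  f a + sumCount (suc a) c f + f (a + suc c)
    ∎

sumCount-vanishing-prefix : ∀ j c (f : ℕ → ℕ) → (∀ k → k < j → f k ≡ 0) →
  sumCount 0 (j + c) f ≡ sumCount j c f
sumCount-vanishing-prefix zero    c f f<j≡0 = refl
sumCount-vanishing-prefix (suc j) c f f<j≡0 = begin
  f 0 + sumCount 1 (j + c) f    ≡⟨ cong (λ x → x + sumCount 1 (j + c) f) (f<j≡0 0 (s≤s z≤n)) ⟩
  sumCount 1 (j + c) f          ≡⟨ sumCount-shift 0 (j + c) f ⟩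
  sumCount 0 (j + c) (f ∘ suc)  ≡⟨ sumCount-vanishing-prefix j c (f ∘ suc) f∘suc<j≡0 ⟩
  sumCount j c (f ∘ suc)        ≡⟨ sumCount-shift j c f ⟨
  sumCount (suc j) c f          ∎
  where
  f∘suc<j≡0 : ∀ k → k < j → f (suc k) ≡ 0
  f∘suc<j≡0 k k<j = f<j≡0 (suc k) (s≤s k<j)

n<k⇒stirling1≡0 : ∀ {n k} → n < k → stirling1 n k ≡ 0
n<k⇒stirling1≡0 {zero}  {suc k} _         = refl
n<k⇒stirling1≡0 {suc n} {suc k} (s≤s n<k) = begin
  n * stirling1 n (suc k) + stirling1 n k
    ≡⟨ cong₂ (λ x y → n * x + y) (n<k⇒stirling1≡0 (m<n⇒m<1+n n<k)) (n<k⇒stirling1≡0 n<k) ⟩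
  n * 0 + 0
    ≡⟨ trans (+-identityʳ (n * 0)) (*-zeroʳ n) ⟩
  0 ∎

k<j⇒stirling2≡0 : ∀ {k j} → k < j → stirling2 k j ≡ 0
k<j⇒stirling2≡0 {zero}  {suc j} _         = refl
k<j⇒stirling2≡0 {suc k} {suc j} (s≤s k<j) = begin
  suc j * stirling2 k (suc j) + stirling2 k j
    ≡⟨ cong₂ (λ x y → suc j * x + y) (k<j⇒stirling2≡0 (m<n⇒m<1+n k<j)) (k<j⇒stirling2≡0 k<j) ⟩
  suc j * 0 + 0
    ≡⟨ trans (+-identityʳ (suc j * 0)) (*-zeroʳ (suc j)) ⟩
  0 ∎

stirling1Sum : ℕ → (ℕ → ℕ) → ℕ
stirling1Sum n g = sumCount 0 (suc n) (λ k → stirling1 (suc n) (suc k) * g k)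

stirling1Sum-cong : ∀ n {g h : ℕ → ℕ} → (∀ k → g k ≡ h k) → stirling1Sum n g ≡ stirling1Sum n h
stirling1Sum-cong n g≗h =
  sumCount-cong 0 (suc n) (λ k → cong (stirling1 (suc n) (suc k) *_) (g≗h k))

stirling1Sum-distrib-+ : ∀ n (g h : ℕ → ℕ) →
  stirling1Sum n (λ k → g k + h k) ≡ stirling1Sum n g + stirling1Sum n h
stirling1Sum-distrib-+ n g h = trans
  (sumCount-cong 0 (suc n) (λ k → *-distribˡ-+ (s₁ k) (g k) (h k)))
  (sumCount-distrib-+ 0 (suc n) (λ k → s₁ k * g k) (λ k → s₁ k * h k))
  where
  s₁ : ℕ → ℕ
  s₁ k = stirling1 (suc n) (suc k)

*-distribˡ-stirling1Sum : ∀ m n (g : ℕ → ℕ) →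
  stirling1Sum n (λ k → m * g k) ≡ m * stirling1Sum n g
*-distribˡ-stirling1Sum m n g = trans
  (sumCount-cong 0 (suc n) (λ k → x∙yz≈y∙xz (stirling1 (suc n) (suc k)) m (g k)))
  (*-distribˡ-sumCount m 0 (suc n) (λ k → stirling1 (suc n) (suc k) * g k))

stirling1Sum-linear : ∀ m n (g h : ℕ → ℕ) →
  stirling1Sum n (λ k → m * g k + h k) ≡ m * stirling1Sum n g + stirling1Sum n h
stirling1Sum-linear m n g h = trans (stirling1Sum-distrib-+ n (λ k → m * g k) h)
  (cong (λ s → s + stirling1Sum n h) (*-distribˡ-stirling1Sum m n g))

stirling1Sum-zero : ∀ n → stirling1Sum n (λ _ → 0) ≡ 0
stirling1Sum-zero n = *-distribˡ-stirling1Sum 0 n (λ _ → 0)   -- 0 * x reduces to 0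

stirling1Sum-suc : ∀ n (g : ℕ → ℕ) →
  stirling1Sum (suc n) g ≡ suc n * stirling1Sum n g + stirling1Sum n (g ∘ suc)
stirling1Sum-suc n g = begin
  sumCount 0 (suc (suc n)) (λ k → stirling1 (suc (suc n)) (suc k) * g k)
    ≡⟨ sumCount-cong 0 (suc (suc n)) (λ k → split (suc n) (s₁ (suc k)) (s₁ k) (g k)) ⟩
  sumCount 0 (suc (suc n)) (λ k → suc n * (s₁ (suc k) * g k) + s₁ k * g k)
    ≡⟨ sumCount-distrib-+ 0 (suc (suc n)) (λ k → suc n * (s₁ (suc k) * g k)) (λ k → s₁ k * g k) ⟩
  sumCount 0 (suc (suc n)) (λ k → suc n * (s₁ (suc k) * g k)) + sumCount 1 (suc n) (λ k → s₁ k * g k)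
    ≡⟨ cong₂ _+_ (*-distribˡ-sumCount (suc n) 0 (suc (suc n)) (λ k → s₁ (suc k) * g k))
                 (sumCount-shift 0 (suc n) (λ k → s₁ k * g k)) ⟩
  suc n * sumCount 0 (suc (suc n)) (λ k → s₁ (suc k) * g k) + stirling1Sum n (g ∘ suc)
    ≡⟨ cong (λ s → suc n * s + stirling1Sum n (g ∘ suc)) (sumCount-last 0 (suc n) (λ k → s₁ (suc k) * g k)) ⟩
  suc n * (stirling1Sum n g + s₁ (suc (suc n)) * g (suc n)) + stirling1Sum n (g ∘ suc)
    ≡⟨ cong (λ x → suc n * (stirling1Sum n g + x * g (suc n)) + stirling1Sum n (g ∘ suc))
            (n<k⇒stirling1≡0 (n<1+n (suc n))) ⟩
  suc n * (stirling1Sum n g + 0) + stirling1Sum n (g ∘ suc)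
    ≡⟨ cong (λ s → suc n * s + stirling1Sum n (g ∘ suc)) (+-identityʳ (stirling1Sum n g)) ⟩
  suc n * stirling1Sum n g + stirling1Sum n (g ∘ suc)
    ∎
  where
  s₁ : ℕ → ℕ
  s₁ = stirling1 (suc n)
  split : ∀ a x y z → (a * x + y) * z ≡ a * (x * z) + y * z
  split = solve-∀

[n+1]*nCk≡[k+1]*[n+1]C[k+1] : ∀ n k → suc n * (n C k) ≡ suc k * (suc n C suc k)
[n+1]*nCk≡[k+1]*[n+1]C[k+1] zero    zero    = refl
[n+1]*nCk≡[k+1]*[n+1]C[k+1] zero    (suc k) = sym (trans
  (cong (suc (suc k) *_) (k>n⇒nCk≡0 {1} {suc (suc k)} (s≤s (s≤s z≤n))))
  (*-zeroʳ (suc (suc k))))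
[n+1]*nCk≡[k+1]*[n+1]C[k+1] (suc n) zero    = trans
  (*-identityʳ (suc (suc n)))
  (sym (trans (*-identityˡ (suc (suc n) C 1)) (nC1≡n (suc (suc n)))))
[n+1]*nCk≡[k+1]*[n+1]C[k+1] (suc n) (suc k) = begin
  suc (suc n) * (suc n C suc k)
    ≡⟨ +-comm (suc n C suc k) (suc n * (suc n C suc k)) ⟩
  suc n * (suc n C suc k) + suc n C suc k
    ≡⟨ cong (λ c → suc n * c + suc n C suc k) (nCk+nC[k+1]≡[n+1]C[k+1] n k) ⟨
  suc n * (n C k + n C suc k) + suc n C suc k
    ≡⟨ cong (_+ suc n C suc k) (*-distribˡ-+ (suc n) (n C k) (n C suc k)) ⟩
  suc n * (n C k) + suc n * (n C suc k) + suc n C suc k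
    ≡⟨ cong₂ (λ x y → x + y + suc n C suc k)
             ([n+1]*nCk≡[k+1]*[n+1]C[k+1] n k) ([n+1]*nCk≡[k+1]*[n+1]C[k+1] n (suc k)) ⟩
  suc k * (suc n C suc k) + suc (suc k) * (suc n C suc (suc k)) + suc n C suc k
    ≡⟨ regroup (suc n C suc k) (suc n C suc (suc k)) ⟩
  suc (suc k) * (suc n C suc k + suc n C suc (suc k))
    ≡⟨ cong (suc (suc k) *_) (nCk+nC[k+1]≡[n+1]C[k+1] (suc n) (suc k)) ⟩
  suc (suc k) * (suc (suc n) C suc (suc k))
    ∎
  where
  regroup : ∀ x y → suc k * x + suc (suc k) * y + x ≡ suc (suc k) * (x + y)
  regroup = solve-∀

[k+1]*nC[k+1]+k*nCk≡n*nCk : ∀ n k → suc k * (n C suc k) + k * (n C k) ≡ n * (n C k)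
[k+1]*nC[k+1]+k*nCk≡n*nCk zero    zero    = refl
[k+1]*nC[k+1]+k*nCk≡n*nCk zero    (suc k) = cong₂ _+_ (*-zeroʳ (suc (suc k))) (*-zeroʳ (suc k))
[k+1]*nC[k+1]+k*nCk≡n*nCk (suc n) zero    = begin
  1 * (suc n C 1) + 0  ≡⟨ +-identityʳ (1 * (suc n C 1)) ⟩
  1 * (suc n C 1)      ≡⟨ *-identityˡ (suc n C 1) ⟩
  suc n C 1            ≡⟨ nC1≡n (suc n) ⟩
  suc n                ≡⟨ *-identityʳ (suc n) ⟨
  suc n * 1            ∎
[k+1]*nC[k+1]+k*nCk≡n*nCk (suc n) (suc k) = begin
  suc (suc k) * (suc n C suc (suc k)) + suc k * (suc n C suc k)
    ≡⟨ cong₂ _+_ ([n+1]*nCk≡[k+1]*[n+1]C[k+1] n (suc k)) ([n+1]*nCk≡[k+1]*[n+1]C[k+1] n k) ⟨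
  suc n * (n C suc k) + suc n * (n C k)
    ≡⟨ *-distribˡ-+ (suc n) (n C suc k) (n C k) ⟨
  suc n * (n C suc k + n C k)
    ≡⟨ cong (suc n *_) (trans (+-comm (n C suc k) (n C k)) (nCk+nC[k+1]≡[n+1]C[k+1] n k)) ⟩
  suc n * (suc n C suc k)
    ∎

mixed₀ : ℕ → ℕ → ℕ
mixed₀ n j = stirling1Sum n (λ k → stirling2 k j)

mixed₁ : ℕ → ℕ → ℕ
mixed₁ n j = stirling1Sum n (λ k → stirling2 k j * k)

mixed₀-suc-zero : ∀ n → mixed₀ (suc n) 0 ≡ suc n * mixed₀ n 0
mixed₀-suc-zero n = begin
  mixed₀ (suc n) 0
    ≡⟨ stirling1Sum-suc n (λ k → stirling2 k 0) ⟩
  suc n * mixed₀ n 0 + stirling1Sum n (λ _ → 0)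
    ≡⟨ cong (λ s → suc n * mixed₀ n 0 + s) (stirling1Sum-zero n) ⟩
  suc n * mixed₀ n 0 + 0
    ≡⟨ +-identityʳ (suc n * mixed₀ n 0) ⟩
  suc n * mixed₀ n 0
    ∎

mixed₀-suc-suc : ∀ n i →
  mixed₀ (suc n) (suc i) ≡ suc n * mixed₀ n (suc i) + (suc i * mixed₀ n (suc i) + mixed₀ n i)
mixed₀-suc-suc n i = trans (stirling1Sum-suc n (λ k → stirling2 k (suc i)))
  (cong (λ s → suc n * mixed₀ n (suc i) + s)
        (stirling1Sum-linear (suc i) n (λ k → stirling2 k (suc i)) (λ k → stirling2 k i)))

mixed₁-zero : ∀ n → mixed₁ n 0 ≡ 0
mixed₁-zero n = trans (stirling1Sum-cong n {h = λ _ → 0} λ { zero → refl ; (suc k) → refl })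
                      (stirling1Sum-zero n)

mixed₁-suc-suc : ∀ n i → mixed₁ (suc n) (suc i) ≡
  suc n * mixed₁ n (suc i)
    + ((suc i * mixed₁ n (suc i) + mixed₁ n i) + (suc i * mixed₀ n (suc i) + mixed₀ n i))
mixed₁-suc-suc n i = trans (stirling1Sum-suc n (λ k → stirling2 k (suc i) * k))
  (cong (λ s → suc n * mixed₁ n (suc i) + s) (begin
    stirling1Sum n (λ k → (suc i * s₂ k + s₂′ k) * suc k)
      ≡⟨ stirling1Sum-cong n (λ k → expand (suc i) (s₂ k) (s₂′ k) k) ⟩
    stirling1Sum n (λ k → (suc i * (s₂ k * k) + s₂′ k * k) + (suc i * s₂ k + s₂′ k))
      ≡⟨ stirling1Sum-distrib-+ n (λ k → suc i * (s₂ k * k) + s₂′ k * k)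
                                  (λ k → suc i * s₂ k + s₂′ k) ⟩
    stirling1Sum n (λ k → suc i * (s₂ k * k) + s₂′ k * k)
      + stirling1Sum n (λ k → suc i * s₂ k + s₂′ k)
      ≡⟨ cong₂ _+_ (stirling1Sum-linear (suc i) n (λ k → s₂ k * k) (λ k → s₂′ k * k))
                   (stirling1Sum-linear (suc i) n s₂ s₂′) ⟩
    (suc i * mixed₁ n (suc i) + mixed₁ n i) + (suc i * mixed₀ n (suc i) + mixed₀ n i)
      ∎))
  where
  s₂ s₂′ : ℕ → ℕ
  s₂  k = stirling2 k (suc i)
  s₂′ k = stirling2 k i
  expand : ∀ a x y k → (a * x + y) * suc k ≡ (a * (x * k) + y * k) + (a * x + y)
  expand = solve-∀

mixed₀-closed : ∀ n j → mixed₀ n j * j ! ≡ (n C j) * n !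
mixed₀-closed zero    zero    = refl
mixed₀-closed zero    (suc i) = refl
mixed₀-closed (suc n) zero    = begin
  mixed₀ (suc n) 0 * 1      ≡⟨ cong (_* 1) (mixed₀-suc-zero n) ⟩
  suc n * mixed₀ n 0 * 1    ≡⟨ *-assoc (suc n) (mixed₀ n 0) 1 ⟩
  suc n * (mixed₀ n 0 * 1)  ≡⟨ cong (suc n *_) (mixed₀-closed n 0) ⟩
  suc n * (1 * n !)         ≡⟨ x∙yz≈y∙xz (suc n) 1 (n !) ⟩
  1 * (suc n * n !)         ∎
mixed₀-closed (suc n) (suc i) = begin
  mixed₀ (suc n) (suc i) * suc i !
    ≡⟨ cong (_* suc i !) (mixed₀-suc-suc n i) ⟩
  (suc n * M₁ + (suc i * M₁ + M₀)) * (suc i * i !)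
    ≡⟨ regroup (suc n) (suc i) M₁ M₀ (i !) ⟩
  (suc n + suc i) * (M₁ * suc i !) + suc i * (M₀ * i !)
    ≡⟨ cong₂ (λ x y → (suc n + suc i) * x + suc i * y) (mixed₀-closed n (suc i)) (mixed₀-closed n i) ⟩
  (suc n + suc i) * ((n C suc i) * n !) + suc i * ((n C i) * n !)
    ≡⟨ regroup′ (suc n) (suc i) (n C i) (n C suc i) (n !) ⟩
  suc n * (n C suc i) * n ! + suc i * (n C i + n C suc i) * n !
    ≡⟨ cong (λ c → suc n * (n C suc i) * n ! + suc i * c * n !) (nCk+nC[k+1]≡[n+1]C[k+1] n i) ⟩
  suc n * (n C suc i) * n ! + suc i * (suc n C suc i) * n !
    ≡⟨ cong (λ c → suc n * (n C suc i) * n ! + c * n !) ([n+1]*nCk≡[k+1]*[n+1]C[k+1] n i) ⟨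
  suc n * (n C suc i) * n ! + suc n * (n C i) * n !
    ≡⟨ regroup″ (suc n) (n C i) (n C suc i) (n !) ⟩
  (n C i + n C suc i) * (suc n * n !)
    ≡⟨ cong (_* suc n !) (nCk+nC[k+1]≡[n+1]C[k+1] n i) ⟩
  (suc n C suc i) * suc n !
    ∎
  where
  M₀ M₁ : ℕ
  M₀ = mixed₀ n i
  M₁ = mixed₀ n (suc i)
  regroup : ∀ a b x y f → (a * x + (b * x + y)) * (b * f) ≡ (a + b) * (x * (b * f)) + b * (y * f)
  regroup = solve-∀
  regroup′ : ∀ a b c₀ c₁ f → (a + b) * (c₁ * f) + b * (c₀ * f) ≡ a * c₁ * f + b * (c₀ + c₁) * f
  regroup′ = solve-∀
  regroup″ : ∀ a c₀ c₁ f → a * c₁ * f + a * c₀ * f ≡ (c₀ + c₁) * (a * f)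
  regroup″ = solve-∀

weight : ℕ → ℕ → ℕ
weight n j = j * (suc n C j) * n !

mixed₁-suc-suc-scaled : ∀ n i → mixed₁ (suc n) (suc i) * suc i ! ≡
  (suc n + suc i) * (mixed₁ n (suc i) * suc i !) + suc i * (mixed₁ n i * i !) + weight n (suc i)
mixed₁-suc-suc-scaled n i = begin
  mixed₁ (suc n) (suc i) * suc i !
    ≡⟨ cong (_* suc i !) (mixed₁-suc-suc n i) ⟩
  (suc n * X₁ + ((suc i * X₁ + X₀) + (suc i * M₁ + M₀))) * (suc i * i !)
    ≡⟨ regroup (suc n) (suc i) X₁ X₀ M₁ M₀ (i !) ⟩
  (suc n + suc i) * (X₁ * suc i !) + suc i * (X₀ * i !) + suc i * (M₁ * suc i ! + M₀ * i !)
    ≡⟨ cong (λ s → (suc n + suc i) * (X₁ * suc i !) + suc i * (X₀ * i !) + s) mixed₀-part ⟩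
  (suc n + suc i) * (X₁ * suc i !) + suc i * (X₀ * i !) + weight n (suc i)
    ∎
  where
  X₀ X₁ M₀ M₁ : ℕ
  X₀ = mixed₁ n i
  X₁ = mixed₁ n (suc i)
  M₀ = mixed₀ n i
  M₁ = mixed₀ n (suc i)
  regroup : ∀ a b x₁ x₀ m₁ m₀ f → (a * x₁ + ((b * x₁ + x₀) + (b * m₁ + m₀))) * (b * f) ≡
    (a + b) * (x₁ * (b * f)) + b * (x₀ * f) + b * (m₁ * (b * f) + m₀ * f)
  regroup = solve-∀
  factor : ∀ b c₀ c₁ f → b * (c₁ * f + c₀ * f) ≡ b * (c₀ + c₁) * f
  factor = solve-∀
  mixed₀-part : suc i * (M₁ * suc i ! + M₀ * i !) ≡ weight n (suc i)
  mixed₀-part = begin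
    suc i * (M₁ * suc i ! + M₀ * i !)
      ≡⟨ cong₂ (λ x y → suc i * (x + y)) (mixed₀-closed n (suc i)) (mixed₀-closed n i) ⟩
    suc i * ((n C suc i) * n ! + (n C i) * n !)
      ≡⟨ factor (suc i) (n C i) (n C suc i) (n !) ⟩
    suc i * (n C i + n C suc i) * n !
      ≡⟨ cong (λ c → suc i * c * n !) (nCk+nC[k+1]≡[n+1]C[k+1] n i) ⟩
    suc i * (suc n C suc i) * n !
      ∎

weight-+ : ∀ n i → weight n i + weight n (suc i) ≡ (suc n C i) * suc n !
weight-+ n i = begin
  i * γ * f + suc i * (suc n C suc i) * f  ≡⟨ regroup (i * γ) (suc i * (suc n C suc i)) f ⟩
  (suc i * (suc n C suc i) + i * γ) * f    ≡⟨ cong (_* f) ([k+1]*nC[k+1]+k*nCk≡n*nCk (suc n) i) ⟩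
  suc n * γ * f                            ≡⟨ reassoc (suc n) γ f ⟩
  γ * (suc n * f)                          ∎
  where
  γ f : ℕ
  γ = suc n C i
  f = n !
  regroup : ∀ β α f → β * f + α * f ≡ (α + β) * f
  regroup = solve-∀
  reassoc : ∀ m c f → m * c * f ≡ c * (m * f)
  reassoc = solve-∀

weight-step : ∀ n i →
  (suc n + suc i) * weight n (suc i) + suc i * weight n i ≡ suc (suc n) * ((suc n C i) * suc n !)
weight-step n i = begin
  (m + suc i) * (α * f) + suc i * (i * γ * f)  ≡⟨ regroup₁ m i α γ f ⟩
  (suc m * α + i * (α + i * γ) + i * γ) * f    ≡⟨ cong (λ s → (suc m * α + i * s + i * γ) * f) α+iγ≡mγ ⟩
  (suc m * α + i * (m * γ) + i * γ) * f        ≡⟨ regroup₂ m i α γ f ⟩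
  suc m * (α + i * γ) * f                      ≡⟨ cong (λ s → suc m * s * f) α+iγ≡mγ ⟩
  suc m * (m * γ) * f                          ≡⟨ regroup₃ m γ f ⟩
  suc m * (γ * (m * f))                        ∎
  where
  m α γ f : ℕ
  m = suc n
  α = suc i * (m C suc i)
  γ = m C i
  f = n !
  α+iγ≡mγ : α + i * γ ≡ m * γ
  α+iγ≡mγ = [k+1]*nC[k+1]+k*nCk≡n*nCk m i
  regroup₁ : ∀ m i α γ f →
    (m + suc i) * (α * f) + suc i * (i * γ * f) ≡ (suc m * α + i * (α + i * γ) + i * γ) * f
  regroup₁ = solve-∀
  regroup₂ : ∀ m i α γ f → (suc m * α + i * (m * γ) + i * γ) * f ≡ suc m * (α + i * γ) * f
  regroup₂ = solve-∀
  regroup₃ : ∀ m γ f → suc m * (m * γ) * f ≡ suc m * (γ * (m * f))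
  regroup₃ = solve-∀

weight-suc-suc : ∀ n i → weight (suc n) (suc i) ≡ suc (suc n) * ((suc n C i) * suc n !)
weight-suc-suc n i = begin
  suc i * (suc (suc n) C suc i) * suc n !
    ≡⟨ cong (_* suc n !) ([n+1]*nCk≡[k+1]*[n+1]C[k+1] (suc n) i) ⟨
  suc (suc n) * (suc n C i) * suc n !
    ≡⟨ *-assoc (suc (suc n)) (suc n C i) (suc n !) ⟩
  suc (suc n) * ((suc n C i) * suc n !)
    ∎

ℚ-ring : AlmostCommutativeRing 0ℓ 0ℓ
ℚ-ring = fromCommutativeRing ℚ.+-*-commutativeRing (λ x → dec⇒maybe (0ℚ ℚ.≟ x))

ι : ℕ → ℚ
ι a = + a / 1

/-cross : ∀ a b c d .{{_ : NonZero b}} .{{_ : NonZero d}} → a * d ≡ c * b → + a / b ≡ + c / d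
/-cross a (suc b) c (suc d) ad≡cb =
  ℚ.fromℚᵘ-cong {mkℚᵘ (+ a) b} {mkℚᵘ (+ c) d} (ℚᵘ.*≡* (begin
  + a ℤ.* + suc d  ≡⟨ ℤ.pos-* a (suc d) ⟨
  + (a * suc d)    ≡⟨ cong +_ ad≡cb ⟩
  + (c * suc b)    ≡⟨ ℤ.pos-* c (suc b) ⟩
  + c ℤ.* + suc b  ∎))

ι-*-/ : ∀ a c d .{{_ : NonZero d}} → ι a *q (+ c / d) ≡ + (a * c) / d
ι-*-/ a c (suc d) = ℚ.toℚᵘ-injective (ℚᵘ.≃-trans lhs (ℚᵘ.≃-sym rhs))
  where
  lhs : toℚᵘ (ι a *q (+ c / suc d)) ℚᵘ.≃ mkℚᵘ (+ a ℤ.* + c) (d + 0)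
  lhs = ℚᵘ.≃-trans (ℚ.toℚᵘ-homo-* (ι a) (+ c / suc d))
                   (ℚᵘ.*-cong (ℚ.toℚᵘ-fromℚᵘ (mkℚᵘ (+ a) 0)) (ℚ.toℚᵘ-fromℚᵘ (mkℚᵘ (+ c) d)))
  rhs : toℚᵘ (+ (a * c) / suc d) ℚᵘ.≃ mkℚᵘ (+ a ℤ.* + c) (d + 0)
  rhs = ℚᵘ.≃-trans (ℚ.toℚᵘ-fromℚᵘ (mkℚᵘ (+ (a * c)) d))
                   (ℚᵘ.≃-reflexive (cong₂ mkℚᵘ (ℤ.pos-* a c) (sym (+-identityʳ d))))

ι-+ : ∀ a b → ι (a + b) ≡ ι a +q ι b
ι-+ a b = ℚ.toℚᵘ-injective (ℚᵘ.≃-trans lhs (ℚᵘ.≃-sym rhs))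
  where
  lhs : toℚᵘ (ι (a + b)) ℚᵘ.≃ mkℚᵘ (+ (a + b)) 0
  lhs = ℚ.toℚᵘ-fromℚᵘ (mkℚᵘ (+ (a + b)) 0)
  regroup : ∀ x y → (x ℤ.* + 1 ℤ.+ y ℤ.* + 1) ℤ.* + 1 ≡ (x ℤ.+ y) ℤ.* + 1
  regroup = ℤ-Solver.solve-∀
  rhs : toℚᵘ (ι a +q ι b) ℚᵘ.≃ mkℚᵘ (+ (a + b)) 0
  rhs = ℚᵘ.≃-trans (ℚ.toℚᵘ-homo-+ (ι a) (ι b)) (ℚᵘ.≃-trans
          (ℚᵘ.+-cong (ℚ.toℚᵘ-fromℚᵘ (mkℚᵘ (+ a) 0)) (ℚ.toℚᵘ-fromℚᵘ (mkℚᵘ (+ b) 0)))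
          (ℚᵘ.*≡* (trans (regroup (+ a) (+ b)) (cong (ℤ._* + 1) (sym (ℤ.pos-+ a b))))))

ι-* : ∀ a b → ι (a * b) ≡ ι a *q ι b
ι-* a b = sym (ι-*-/ a b 1)

ι-*-cong : ∀ a x y d → ι x ≡ ι y *q d → ι (a * x) ≡ ι (a * y) *q d
ι-*-cong a x y d ιx≡ιy*d = begin
  ι (a * x)          ≡⟨ ι-* a x ⟩
  ι a *q ι x         ≡⟨ cong (ι a *q_) ιx≡ιy*d ⟩
  ι a *q (ι y *q d)  ≡⟨ ℚ.*-assoc (ι a) (ι y) d ⟨
  ι a *q ι y *q d    ≡⟨ cong (_*q d) (ι-* a y) ⟨
  ι (a * y) *q d     ∎

ι-*-recip : ∀ m a .{{_ : NonZero m}} → ι (m * a) *q (+ 1 / m) ≡ ι a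
ι-*-recip m a = trans (ι-*-/ (m * a) 1 m) (/-cross (m * a * 1) m a 1 (reorder m a))
  where
  reorder : ∀ m a → m * a * 1 * 1 ≡ a * m
  reorder = solve-∀

ι-*-shift : ∀ m a d → ι (suc m * a) *q (d +q + 1 / suc m) ≡ ι (suc m * a) *q d +q ι a
ι-*-shift m a d = begin
  ι (suc m * a) *q (d +q + 1 / suc m)
    ≡⟨ ℚ.*-distribˡ-+ (ι (suc m * a)) d (+ 1 / suc m) ⟩
  ι (suc m * a) *q d +q ι (suc m * a) *q (+ 1 / suc m)
    ≡⟨ cong (ι (suc m * a) *q d +q_) (ι-*-recip (suc m) a) ⟩
  ι (suc m * a) *q d +q ι a
    ∎

ι[x*m]≡ι[y]*d⇒ι[x]≡[y/m]*d : ∀ x m y d .{{_ : NonZero m}} →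
  ι (x * m) ≡ ι y *q d → ι x ≡ (+ y / m) *q d
ι[x*m]≡ι[y]*d⇒ι[x]≡[y/m]*d x m y d ι[x*m]≡ι[y]*d = begin
  ι x                     ≡⟨ ι-*-recip m x ⟨
  ι (m * x) *q (+ 1 / m)  ≡⟨ cong (λ z → ι z *q (+ 1 / m)) (*-comm m x) ⟩
  ι (x * m) *q (+ 1 / m)  ≡⟨ cong (_*q (+ 1 / m)) ι[x*m]≡ι[y]*d ⟩
  ι y *q d *q (+ 1 / m)   ≡⟨ swap (ι y) d (+ 1 / m) ⟩
  ι y *q (+ 1 / m) *q d   ≡⟨ cong (_*q d) (ι-*-/ y 1 m) ⟩
  (+ (y * 1) / m) *q d    ≡⟨ cong (λ z → (+ z / m) *q d) (*-identityʳ y) ⟩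
  (+ y / m) *q d          ∎
  where
  swap : ∀ a b c → a *q b *q c ≡ a *q c *q b
  swap = RingSolver.solve-∀ ℚ-ring

H[m+1]-x≡H[m]-x+1/[m+1] : ∀ m x → harmonic (suc m) -q x ≡ (harmonic m -q x) +q + 1 / suc m
H[m+1]-x≡H[m]-x+1/[m+1] m x = regroup (harmonic m) (+ 1 / suc m) x
  where
  regroup : ∀ h r x → (h +q r) -q x ≡ (h -q x) +q r
  regroup = RingSolver.solve-∀ ℚ-ring

x-H[m]≡x-H[m+1]+1/[m+1] : ∀ m x → x -q harmonic m ≡ (x -q harmonic (suc m)) +q + 1 / suc m
x-H[m]≡x-H[m+1]+1/[m+1] m x = regroup (harmonic m) (+ 1 / suc m) x
  where
  regroup : ∀ h r x → x -q h ≡ (x -q (h +q r)) +q r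
  regroup = RingSolver.solve-∀ ℚ-ring

mixed₁-closed : ∀ n j → ι (mixed₁ n j * j !) ≡ ι (weight n j) *q (harmonic (suc n) -q harmonic j)
mixed₁-closed n       zero          = trans
  (cong (λ s → ι (s * 1)) (mixed₁-zero n))
  (sym (ℚ.*-zeroˡ (harmonic (suc n) -q harmonic 0)))
mixed₁-closed zero    (suc zero)    = refl
mixed₁-closed zero    (suc (suc i)) = sym (trans
  (cong (λ w → ι w *q (harmonic 1 -q harmonic (suc (suc i)))) weight≡0)
  (ℚ.*-zeroˡ (harmonic 1 -q harmonic (suc (suc i)))))
  where
  weight≡0 : weight 0 (suc (suc i)) ≡ 0
  weight≡0 = trans (cong (λ c → suc (suc i) * c * 1) (k>n⇒nCk≡0 {1} {suc (suc i)} (s≤s (s≤s z≤n))))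
                   (cong (_* 1) (*-zeroʳ (suc (suc i))))
mixed₁-closed (suc n) (suc i) = begin
  ι (mixed₁ (suc n) (suc i) * suc i !)
    ≡⟨ cong ι (mixed₁-suc-suc-scaled n i) ⟩
  ι (a * X₁ + suc i * X₀ + p)
    ≡⟨ trans (ι-+ (a * X₁ + suc i * X₀) p) (cong (_+q ι p) (ι-+ (a * X₁) (suc i * X₀))) ⟩
  ι (a * X₁) +q ι (suc i * X₀) +q ι p
    ≡⟨ cong₂ (λ x y → x +q y +q ι p) IH₁ IH₀ ⟩
  ι (a * p) *q d +q ι (suc i * q) *q (d +q + 1 / suc i) +q ι p
    ≡⟨ cong (λ x → ι (a * p) *q d +q x +q ι p) (ι-*-shift i q d) ⟩
  ι (a * p) *q d +q (ι (suc i * q) *q d +q ι q) +q ι p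
    ≡⟨ regroup (ι (a * p)) (ι (suc i * q)) (ι q) (ι p) d ⟩
  (ι (a * p) +q ι (suc i * q)) *q d +q (ι q +q ι p)
    ≡⟨ cong₂ (λ x y → x *q d +q y) (ι-+ (a * p) (suc i * q)) (ι-+ q p) ⟨
  ι (a * p + suc i * q) *q d +q ι (q + p)
    ≡⟨ cong₂ (λ x y → ι x *q d +q ι y) (weight-step n i) (weight-+ n i) ⟩
  ι (suc (suc n) * r) *q d +q ι r
    ≡⟨ ι-*-shift (suc n) r d ⟨
  ι (suc (suc n) * r) *q (d +q + 1 / suc (suc n))
    ≡⟨ cong₂ (λ w h → ι w *q h) (weight-suc-suc n i) (H[m+1]-x≡H[m]-x+1/[m+1] (suc n) (harmonic (suc i))) ⟨
  ι (weight (suc n) (suc i)) *q (harmonic (suc (suc n)) -q harmonic (suc i))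
    ∎
  where
  a X₀ X₁ p q r : ℕ
  a  = suc n + suc i
  X₀ = mixed₁ n i * i !
  X₁ = mixed₁ n (suc i) * suc i !
  p  = weight n (suc i)
  q  = weight n i
  r  = (suc n C i) * suc n !
  d : ℚ
  d = harmonic (suc n) -q harmonic (suc i)
  IH₁ : ι (a * X₁) ≡ ι (a * p) *q d
  IH₁ = ι-*-cong a X₁ p d (mixed₁-closed n (suc i))
  IH₀ : ι (suc i * X₀) ≡ ι (suc i * q) *q (d +q + 1 / suc i)
  IH₀ = ι-*-cong (suc i) X₀ q (d +q + 1 / suc i)
          (trans (mixed₁-closed n i) (cong (ι q *q_) (x-H[m]≡x-H[m+1]+1/[m+1] i (harmonic (suc n)))))
  regroup : ∀ a b x y d → a *q d +q (b *q d +q x) +q y ≡ (a +q b) *q d +q (x +q y)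
  regroup = RingSolver.solve-∀ ℚ-ring

sumFromTo≡mixed₁ : ∀ n j → j ≤ suc n →
  sumFromTo j n (λ k → stirling1 (suc n) (suc k) * stirling2 k j * k) ≡ mixed₁ n j
sumFromTo≡mixed₁ n j j≤1+n = begin
  sumCount j (suc n ∸ j) f        ≡⟨ sumCount-vanishing-prefix j (suc n ∸ j) f f<j≡0 ⟨
  sumCount 0 (j + (suc n ∸ j)) f  ≡⟨ cong (λ c → sumCount 0 c f) (m+[n∸m]≡n j≤1+n) ⟩
  sumCount 0 (suc n) f            ≡⟨ sumCount-cong 0 (suc n) (λ k → *-assoc (s₁ k) (stirling2 k j) k) ⟩
  mixed₁ n j                      ∎
  where
  s₁ f : ℕ → ℕ
  s₁ k = stirling1 (suc n) (suc k)
  f  k = s₁ k * stirling2 k j * k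
  f<j≡0 : ∀ k → k < j → f k ≡ 0
  f<j≡0 k k<j = cong (_* k) (trans (cong (s₁ k *_) (k<j⇒stirling2≡0 k<j)) (*-zeroʳ (s₁ k)))

theorem3 : (n j : ℕ) → 1 ≤ j → j ≤ n →
    (+ sumFromTo j n (λ k → stirling1 (suc n) (suc k) * stirling2 k j * k) / 1)
      ≡ ((+ (suc n C j) / 1) *q factQ n (j ∸ 1)) *q (harmonic (suc n) -q harmonic j)
theorem3 n (suc i) _ i<n = begin
  ι (sumFromTo (suc i) n (λ k → stirling1 (suc n) (suc k) * stirling2 k (suc i) * k))
    ≡⟨ cong ι (sumFromTo≡mixed₁ n (suc i) (m≤n⇒m≤1+n i<n)) ⟩
  ι (mixed₁ n (suc i))
    ≡⟨ ι[x*m]≡ι[y]*d⇒ι[x]≡[y/m]*d (mixed₁ n (suc i)) (suc i !) (weight n (suc i)) D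
                                   (mixed₁-closed n (suc i)) ⟩
  (+ weight n (suc i) / suc i !) *q D
    ≡⟨ cong (_*q D) weight/[i+1]!≡C*n!/i! ⟩
  (ι (suc n C suc i) *q factQ n i) *q D
    ∎
  where
  instance
    [i+1]!≢0 : NonZero (suc i !)
    [i+1]!≢0 = suc i !≢0
    i!≢0 : NonZero (i !)
    i!≢0 = i !≢0
  D : ℚ
  D = harmonic (suc n) -q harmonic (suc i)
  cancel : ∀ a c f g → a * c * f * g ≡ c * f * (a * g)
  cancel = solve-∀
  weight/[i+1]!≡C*n!/i! : + weight n (suc i) / suc i ! ≡ ι (suc n C suc i) *q factQ n i
  weight/[i+1]!≡C*n!/i! = trans
    (/-cross (weight n (suc i)) (suc i !) ((suc n C suc i) * n !) (i !)
             (cancel (suc i) (suc n C suc i) (n !) (i !)))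
    (sym (ι-*-/ (suc n C suc i) (n !) (i !)))
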